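{- For integers $2\le k\le n-2$, the number of pairs $(i,J)$ with $m\in\{2,\ldots,k\}$, $i\in\{1,\ldots,k-(m-1)\}$ and $J$ an $m$-element subset of $\{1,\ldots,(n-2)-(k-m)\}$ (i.e. the number of Minkowski summands in the PK associahedron $\mathbb K^{(k)}_{n-k}$) is $$\sum_{m=2}^k(k-(m-1))\binom{(n-2)-(k-m)}{m}=\binom nk-k(n-k)-1.$$
   Context: The PK associahedron $\mathbb K^{(k)}_{n-k}$ is defined in the paper as a Minkowski sum of polytopes (planar faces) $\mathcal F^{(i)}_J$ indexed exactly by the pairs $(i,J)$ described in the claim, one summand per pair. -}

module Defs where

open import Data.Nat using (ℕ; zero; suc; _+_; _*_; _∸_; _≟_)
open import Data.Nat.Combinatorics using (_C_)
open import Data.Bool using (Bool; true; false)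
open import Data.Vec using (Vec; []; _∷_)
open import Data.List using (List; []; _∷_; map; concatMap; filter; length; upTo)
open import Data.Nat.ListAction using (sum)
open import Data.Product using (_×_; _,_)
open import Data.Fin.Subset using (Subset; ∣_∣)
open import Relation.Unary using (Decidable)

allSubsets : (N : ℕ) → List (Subset N)
allSubsets zero    = [] ∷ []
allSubsets (suc N) = concatMap (λ s → (false ∷ s) ∷ (true ∷ s) ∷ []) (allSubsets N)

-- The m-element subsets of Fin N  (J ⊆ {1,…,N}, indexed from 0).
subsetsOfSize : (N m : ℕ) → List (Subset N)
subsetsOfSize N m = filter (λ s → ∣ s ∣ ≟ m) (allSubsets N)

pairsFor : (n k m : ℕ) → List (ℕ × Subset ((n ∸ 2) ∸ (k ∸ m)))
pairsFor n k m =
  concatMap (λ i → map (λ J → (suc i , J)) (subsetsOfSize ((n ∸ 2) ∸ (k ∸ m)) m))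
            (upTo (k ∸ (m ∸ 1)))

range2to : ℕ → List ℕ
range2to k = map (λ j → 2 + j) (upTo (k ∸ 1))

numPairs : (n k : ℕ) → ℕ
numPairs n k = sum (map (λ m → length (pairsFor n k m)) (range2to k))

pkSum : (n k : ℕ) → ℕ
pkSum n k = sum (map (λ m → (k ∸ (m ∸ 1)) * (((n ∸ 2) ∸ (k ∸ m)) C m)) (range2to k))

module Submission where

-- Counting the pairs (i , J) gives the sum directly, once the m-element subsets of an
-- N-set are counted by N C m (Pascal's rule, splitting on the first element).
-- Writing k = b + 1 and n = b + 1 + q, the sum becomes Σ_{j<b} (b - j) C(q + j, j + 2).
-- Since the weight b - j counts the partial sums containing the j-th term, the sum is
-- Σ_{i<b} Σ_{j≤i} C(q + j, j + 2); the hockey-stick identity evaluates each partial sum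
-- as C(q + i + 1, i + 2) - q, and a second hockey stick gives C(n, k) - k q - 1.

open import Defs
open import Data.Bool using (Bool; true; false)
open import Data.Nat using (ℕ; zero; suc; _+_; _*_; _∸_; _≤_; _<_; _≟_)
open import Data.Nat.Properties
  using (+-comm; +-assoc; +-identityʳ; +-suc; +-∸-comm; +-∸-assoc; m+n∸m≡n; m∸n≤m; m∸[m∸n]≡n;
         n∸n≡0; ≤-pred; ≤-refl; ≤-trans; m≤n⇒m≤1+n; m≤n⇒∃[o]m+o≡n)
open import Data.Nat.Combinatorics using (_C_; nC1≡n; nCk+nC[k+1]≡[n+1]C[k+1])
open import Data.Nat.ListAction using (sum)
open import Data.Nat.Tactic.RingSolver using (solve-∀)
open import Data.Fin.Subset using (Subset; ∣_∣)
open import Data.Vec using (_∷_)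
open import Data.List using (List; []; _∷_; map; concatMap; filter; length; applyUpTo; upTo)
open import Data.List.Properties using (map-cong; map-∘; map-upTo; length-map; length-++; length-upTo)
open import Data.Product using (_×_; _,_)
open import Relation.Nullary using (does)
open import Relation.Binary.PropositionalEquality
open ≡-Reasoning

indicator : Bool → ℕ
indicator false = 0
indicator true  = 1

countOfSize : ∀ {N} → ℕ → List (Subset N) → ℕ
countOfSize m ss = length (filter (λ s → ∣ s ∣ ≟ m) ss)

countOfSize-∷ : ∀ {N} m (s : Subset N) ss →
  countOfSize m (s ∷ ss) ≡ indicator (does (∣ s ∣ ≟ m)) + countOfSize m ss
countOfSize-∷ m s ss with does (∣ s ∣ ≟ m)
... | false = refl
... | true  = refl

extend : ∀ {N} → Subset N → List (Subset (suc N))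
extend s = (false ∷ s) ∷ (true ∷ s) ∷ []

-- In both lemmas the test on ∣ true ∷ s ∣ reduces to the one on ∣ s ∣ (or to false),
-- because ∣ true ∷ s ∣ = suc ∣ s ∣ and ≟ on ℕ computes by ≡ᵇ.
countOfSize-zero-extend : ∀ {N} (ss : List (Subset N)) →
  countOfSize 0 (concatMap extend ss) ≡ countOfSize 0 ss
countOfSize-zero-extend []       = refl
countOfSize-zero-extend (s ∷ ss) = begin
  countOfSize 0 (concatMap extend (s ∷ ss))
    ≡⟨ countOfSize-∷ 0 (false ∷ s) _ ⟩
  indicator (does (∣ s ∣ ≟ 0)) + countOfSize 0 (concatMap extend ss)
    ≡⟨ cong (_ +_) (countOfSize-zero-extend ss) ⟩
  indicator (does (∣ s ∣ ≟ 0)) + countOfSize 0 ss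
    ≡⟨ countOfSize-∷ 0 s ss ⟨
  countOfSize 0 (s ∷ ss) ∎

countOfSize-suc-extend : ∀ {N} m (ss : List (Subset N)) →
  countOfSize (suc m) (concatMap extend ss) ≡ countOfSize (suc m) ss + countOfSize m ss
countOfSize-suc-extend m []       = refl
countOfSize-suc-extend m (s ∷ ss) = begin
  countOfSize (suc m) (concatMap extend (s ∷ ss))
    ≡⟨ countOfSize-∷ (suc m) (false ∷ s) _ ⟩
  a + countOfSize (suc m) ((true ∷ s) ∷ concatMap extend ss)
    ≡⟨ cong (a +_) (countOfSize-∷ (suc m) (true ∷ s) _) ⟩
  a + (b + countOfSize (suc m) (concatMap extend ss))
    ≡⟨ cong (λ r → a + (b + r)) (countOfSize-suc-extend m ss) ⟩
  a + (b + (countOfSize (suc m) ss + countOfSize m ss))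
    ≡⟨ interchange a b _ _ ⟩
  (a + countOfSize (suc m) ss) + (b + countOfSize m ss)
    ≡⟨ cong₂ _+_ (countOfSize-∷ (suc m) s ss) (countOfSize-∷ m s ss) ⟨
  countOfSize (suc m) (s ∷ ss) + countOfSize m (s ∷ ss) ∎
  where
  a b : ℕ
  a = indicator (does (∣ s ∣ ≟ suc m))
  b = indicator (does (∣ s ∣ ≟ m))
  interchange : ∀ a b c d → a + (b + (c + d)) ≡ (a + c) + (b + d)
  interchange = solve-∀

length-subsetsOfSize : ∀ N m → length (subsetsOfSize N m) ≡ N C m
length-subsetsOfSize zero    zero    = refl
length-subsetsOfSize zero    (suc m) = refl
length-subsetsOfSize (suc N) zero    =
  trans (countOfSize-zero-extend (allSubsets N)) (length-subsetsOfSize N zero)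
length-subsetsOfSize (suc N) (suc m) = begin
  countOfSize (suc m) (concatMap extend (allSubsets N))
    ≡⟨ countOfSize-suc-extend m (allSubsets N) ⟩
  countOfSize (suc m) (allSubsets N) + countOfSize m (allSubsets N)
    ≡⟨ cong₂ _+_ (length-subsetsOfSize N (suc m)) (length-subsetsOfSize N m) ⟩
  N C suc m + N C m
    ≡⟨ +-comm (N C suc m) (N C m) ⟩
  N C m + N C suc m
    ≡⟨ nCk+nC[k+1]≡[n+1]C[k+1] N m ⟩
  suc N C suc m ∎

length-concatMap-map : ∀ {A B C : Set} (f : A → B → C) (xs : List A) (ys : List B) →
  length (concatMap (λ x → map (f x) ys) xs) ≡ length xs * length ys
length-concatMap-map f []       ys = refl
length-concatMap-map f (x ∷ xs) ys = trans (length-++ (map (f x) ys))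
  (cong₂ _+_ (length-map (f x) ys) (length-concatMap-map f xs ys))

numPairs≡pkSum : ∀ n k → numPairs n k ≡ pkSum n k
numPairs≡pkSum n k = cong sum (map-cong length-pairsFor (range2to k))
  where
  length-pairsFor : ∀ m → length (pairsFor n k m) ≡ (k ∸ (m ∸ 1)) * (((n ∸ 2) ∸ (k ∸ m)) C m)
  length-pairsFor m = trans
    (length-concatMap-map (λ i J → (suc i , J)) (upTo (k ∸ (m ∸ 1))) (subsetsOfSize _ m))
    (cong₂ _*_ (length-upTo (k ∸ (m ∸ 1))) (length-subsetsOfSize ((n ∸ 2) ∸ (k ∸ m)) m))

sumBelow : (ℕ → ℕ) → ℕ → ℕ
sumBelow f zero    = 0
sumBelow f (suc n) = sumBelow f n + f n

sumBelow-suc-shift : ∀ f n → sumBelow f (suc n) ≡ f 0 + sumBelow (λ j → f (suc j)) n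
sumBelow-suc-shift f zero    = +-comm 0 (f 0)
sumBelow-suc-shift f (suc n) =
  trans (cong (_+ f (suc n)) (sumBelow-suc-shift f n)) (+-assoc (f 0) _ _)

sum-applyUpTo : ∀ f n → sum (applyUpTo f n) ≡ sumBelow f n
sum-applyUpTo f zero    = refl
sum-applyUpTo f (suc n) =
  trans (cong (f 0 +_) (sum-applyUpTo (λ j → f (suc j)) n)) (sym (sumBelow-suc-shift f n))

sumBelow-cong : ∀ {f g} n → (∀ j → j < n → f j ≡ g j) → sumBelow f n ≡ sumBelow g n
sumBelow-cong zero    f≡g = refl
sumBelow-cong (suc n) f≡g =
  cong₂ _+_ (sumBelow-cong n (λ j j<n → f≡g j (m≤n⇒m≤1+n j<n))) (f≡g n ≤-refl)

sumBelow-+ : ∀ f g n → sumBelow (λ j → f j + g j) n ≡ sumBelow f n + sumBelow g n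
sumBelow-+ f g zero    = refl
sumBelow-+ f g (suc n) =
  trans (cong (_+ (f n + g n)) (sumBelow-+ f g n)) (interchange (sumBelow f n) _ (f n) _)
  where
  interchange : ∀ a b c d → a + b + (c + d) ≡ a + c + (b + d)
  interchange = solve-∀

weightedSum : (ℕ → ℕ) → ℕ → ℕ
weightedSum c n = sumBelow (λ j → (n ∸ j) * c j) n

weightedSum-suc : ∀ c n → weightedSum c (suc n) ≡ weightedSum c n + sumBelow c (suc n)
weightedSum-suc c n = begin
  sumBelow (λ j → (suc n ∸ j) * c j) (suc n)
    ≡⟨ sumBelow-cong (suc n) weight-suc ⟩
  sumBelow (λ j → (n ∸ j) * c j + c j) (suc n)
    ≡⟨ sumBelow-+ (λ j → (n ∸ j) * c j) c (suc n) ⟩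
  weightedSum c n + (n ∸ n) * c n + sumBelow c (suc n)
    ≡⟨ cong (λ w → weightedSum c n + w * c n + sumBelow c (suc n)) (n∸n≡0 n) ⟩
  weightedSum c n + 0 + sumBelow c (suc n)
    ≡⟨ cong (_+ sumBelow c (suc n)) (+-identityʳ (weightedSum c n)) ⟩
  weightedSum c n + sumBelow c (suc n) ∎
  where
  weight-suc : ∀ j → j < suc n → (suc n ∸ j) * c j ≡ (n ∸ j) * c j + c j
  weight-suc j j<1+n =
    trans (cong (_* c j) (+-∸-assoc 1 (≤-pred j<1+n))) (+-comm (c j) _)

hockeyStick : ∀ q n → sumBelow (λ j → (q + j) C (2 + j)) n + q ≡ (q + n) C suc n
hockeyStick q zero    = sym (trans (cong (_C 1) (+-identityʳ q)) (nC1≡n q))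
hockeyStick q (suc n) = begin
  sumBelow c n + c n + q
    ≡⟨ swap (sumBelow c n) (c n) q ⟩
  sumBelow c n + q + c n
    ≡⟨ cong (_+ c n) (hockeyStick q n) ⟩
  (q + n) C suc n + (q + n) C (2 + n)
    ≡⟨ nCk+nC[k+1]≡[n+1]C[k+1] (q + n) (suc n) ⟩
  suc (q + n) C (2 + n)
    ≡⟨ cong (_C (2 + n)) (+-suc q n) ⟨
  (q + suc n) C (2 + n) ∎
  where
  c : ℕ → ℕ
  c j = (q + j) C (2 + j)
  swap : ∀ a b d → a + b + d ≡ a + d + b
  swap = solve-∀

weightedHockeyStick : ∀ q n →
  weightedSum (λ j → (q + j) C (2 + j)) n + suc n * q + 1 ≡ (q + suc n) C suc n
weightedHockeyStick q zero    = trans (cong (_+ 1) (+-identityʳ q)) (sym (nC1≡n (q + 1)))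
weightedHockeyStick q (suc n) = begin
  weightedSum c (suc n) + suc (suc n) * q + 1
    ≡⟨ cong (λ w → w + suc (suc n) * q + 1) (weightedSum-suc c n) ⟩
  weightedSum c n + sumBelow c (suc n) + suc (suc n) * q + 1
    ≡⟨ regroup (weightedSum c n) (sumBelow c (suc n)) q n ⟩
  (weightedSum c n + suc n * q + 1) + (sumBelow c (suc n) + q)
    ≡⟨ cong₂ _+_ (weightedHockeyStick q n) (hockeyStick q (suc n)) ⟩
  (q + suc n) C suc n + (q + suc n) C (2 + n)
    ≡⟨ nCk+nC[k+1]≡[n+1]C[k+1] (q + suc n) (suc n) ⟩
  suc (q + suc n) C (2 + n)
    ≡⟨ cong (_C (2 + n)) (+-suc q (suc n)) ⟨
  (q + suc (suc n)) C (2 + n) ∎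
  where
  c : ℕ → ℕ
  c j = (q + j) C (2 + j)
  regroup : ∀ w s q n → w + s + suc (suc n) * q + 1 ≡ (w + suc n * q + 1) + (s + q)
  regroup = solve-∀

pkSum≡weightedSum : ∀ b q → pkSum (suc b + q) (suc b) ≡ weightedSum (λ j → (q + j) C (2 + j)) b
pkSum≡weightedSum b q = begin
  sum (map term (map (2 +_) (upTo b)))
    ≡⟨ cong sum (map-∘ (upTo b)) ⟨
  sum (map (λ j → term (2 + j)) (upTo b))
    ≡⟨ cong sum (map-upTo (λ j → term (2 + j)) b) ⟩
  sum (applyUpTo (λ j → term (2 + j)) b)
    ≡⟨ sum-applyUpTo (λ j → term (2 + j)) b ⟩
  sumBelow (λ j → term (2 + j)) b
    ≡⟨ sumBelow-cong b (λ j j<b → cong (λ N → (b ∸ j) * (N C (2 + j))) (ground-set b j j<b)) ⟩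
  weightedSum (λ j → (q + j) C (2 + j)) b ∎
  where
  term : ℕ → ℕ
  term m = (suc b ∸ (m ∸ 1)) * (((suc b + q ∸ 2) ∸ (suc b ∸ m)) C m)
  ground-set : ∀ b j → j < b → (suc b + q ∸ 2) ∸ (suc b ∸ (2 + j)) ≡ q + j
  ground-set (suc b) j j<1+b = begin
    (b + q) ∸ (b ∸ j)   ≡⟨ +-∸-comm q (m∸n≤m b j) ⟩
    (b ∸ (b ∸ j)) + q   ≡⟨ cong (_+ q) (m∸[m∸n]≡n (≤-pred j<1+b)) ⟩
    j + q               ≡⟨ +-comm j q ⟩
    q + j               ∎

pkSum-binomial : ∀ n k → k ≤ n → pkSum n k + k * (n ∸ k) + 1 ≡ n C k
pkSum-binomial n zero    _   = refl
pkSum-binomial n (suc b) b<n with m≤n⇒∃[o]m+o≡n b<n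
... | q , refl = begin
  pkSum (suc b + q) (suc b) + suc b * (suc b + q ∸ suc b) + 1
    ≡⟨ cong₂ (λ s d → s + suc b * d + 1) (pkSum≡weightedSum b q) (m+n∸m≡n (suc b) q) ⟩
  weightedSum (λ j → (q + j) C (2 + j)) b + suc b * q + 1
    ≡⟨ weightedHockeyStick q b ⟩
  (q + suc b) C suc b
    ≡⟨ cong (_C suc b) (+-comm q (suc b)) ⟩
  (suc b + q) C suc b ∎

mainTheorem8 : (n k : ℕ) → 2 ≤ k → k ≤ n ∸ 2 →
    (numPairs n k ≡ pkSum n k) × (pkSum n k + k * (n ∸ k) + 1 ≡ n C k)
mainTheorem8 n k _ k≤n∸2 =
  numPairs≡pkSum n k , pkSum-binomial n k (≤-trans k≤n∸2 (m∸n≤m n 2))
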